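{- Let $R$ be a Dedekind domain and let $I$ be a nonzero ideal of $R$ such that $R/I$ is finite and nontrivial, with factorization $I=P_1^{\alpha_1}\cdots P_t^{\alpha_t}$ into powers of distinct prime ideals. For any $a,b\in R$, the number of common neighbors of the vertices $a+I$ and $b+I$ in $G_{R/I}$ equals \[F(a-b)=|R/I|\prod_{i=1}^t\left(1-\frac{\varepsilon(P_i,a-b)}{|R/P_i|}\right).\]
   Context: $G_{R/I}$ is the unitary Cayley graph of $R/I$: vertex set $R/I$, with $c+I$, $d+I$ adjacent iff $c-d+I$ is a unit of $R/I$. For a prime ideal $P$ and $s\in R$, $\varepsilon(P,s)=1$ if $s\in P$ and $\varepsilon(P,s)=2$ if $s\notin P$. -}

module Defs where

open import Level using (Level; _⊔_; Lift)
open import Algebra.Bundles using (CommutativeRing)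
import Algebra.Properties.Group as GroupProps
open import Data.Nat using (ℕ; zero; suc; _≤_) renaming (_*_ to _*ℕ_; _+_ to _+ℕ_)
open import Data.Fin using (Fin; zero; suc)
open import Data.Fin.Properties using () renaming (_≟_ to _≟F_)
open import Data.List using (List; []; _∷_; map; concatMap; replicate; foldr)
open import Data.List.Relation.Unary.All using (All)
open import Data.Product using (Σ; ∃; _×_; _,_; proj₁; proj₂)
open import Data.Sum using (_⊎_)
open import Relation.Nullary using (¬_; Dec; yes; no)
open import Relation.Binary.PropositionalEquality using (_≡_)
open import Function.Bundles using (_⇔_)
import Data.List as List

prodFin : (t : ℕ) → (Fin t → ℕ) → ℕ
prodFin zero    f = 1
prodFin (suc t) f = f zero *ℕ prodFin t (λ i → f (suc i))

εDec : ∀ {a} {A : Set a} → Dec A → ℕ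
εDec (yes _) = 1
εDec (no  _) = 2

module _ {c ℓ} (R : CommutativeRing c ℓ) where
  open CommutativeRing R hiding (zero)

  Pred : Set (Level.suc (c ⊔ ℓ))
  Pred = Carrier → Set (c ⊔ ℓ)

  record Ideal : Set (Level.suc (c ⊔ ℓ)) where
    field
      mem      : Carrier → Set (c ⊔ ℓ)
      mem-resp : ∀ {x y} → x ≈ y → mem x → mem y
      mem-0    : mem 0#
      mem-+    : ∀ {x y} → mem x → mem y → mem (x + y)
      mem-*    : ∀ x {y} → mem y → mem (x * y)

  open Ideal public

  _⊆I_ : Ideal → Ideal → Set (c ⊔ ℓ)
  I ⊆I J = ∀ x → mem I x → mem J x

  SameIdeal : Ideal → Ideal → Set (c ⊔ ℓ)
  SameIdeal I J = (I ⊆I J) × (J ⊆I I)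

  NonzeroIdeal : Ideal → Set (c ⊔ ℓ)
  NonzeroIdeal I = Σ Carrier λ x → mem I x × ¬ (x ≈ 0#)

  IsPrimeIdeal : Ideal → Set (c ⊔ ℓ)
  IsPrimeIdeal P = (¬ mem P 1#) × (∀ x y → mem P (x * y) → mem P x ⊎ mem P y)

  IsMaximalIdeal : Ideal → Set (Level.suc (c ⊔ ℓ))
  IsMaximalIdeal M = (¬ mem M 1#) × (∀ (J : Ideal) → M ⊆I J → (J ⊆I M) ⊎ mem J 1#)

  pow : Carrier → ℕ → Carrier
  pow x zero    = 1#
  pow x (suc n) = x * pow x n

  sumFinR : (n : ℕ) → (Fin n → Carrier) → Carrier
  sumFinR zero    f = 0#
  sumFinR (suc n) f = f zero + sumFinR n (λ i → f (suc i))

  toℕ' : ∀ {n} → Fin n → ℕ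
  toℕ' = Data.Fin.toℕ

  -- y^n p(x/y) for the monic polynomial p(T) = T^n + Σ_{k<n} c_k T^k
  monicHom : (n : ℕ) → (Fin n → Carrier) → Carrier → Carrier → Carrier
  monicHom n cs x y =
    pow x n + sumFinR n (λ k → cs k * (pow x (toℕ' k) * pow y (n Data.Nat.∸ toℕ' k)))

  IsIntegralDomain : Set (c ⊔ ℓ)
  IsIntegralDomain = (¬ (0# ≈ 1#)) × (∀ x y → x * y ≈ 0# → (x ≈ 0#) ⊎ (y ≈ 0#))

  IsNoetherian : Set (Level.suc (c ⊔ ℓ))
  IsNoetherian = ∀ (C : ℕ → Ideal) → (∀ n → C n ⊆I C (suc n)) →
                 Σ ℕ λ N → ∀ m → N ≤ m → C m ⊆I C N

  -- integrally closed in its field of fractions: if x/y (y ≠ 0) is a root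
  -- of a monic polynomial over R, then x/y ∈ R, i.e. y divides x.
  IsIntegrallyClosed : Set (c ⊔ ℓ)
  IsIntegrallyClosed = ∀ x y → ¬ (y ≈ 0#) → (n : ℕ) → (cs : Fin n → Carrier) →
                       monicHom n cs x y ≈ 0# → Σ Carrier λ z → x ≈ y * z

  IsDedekindDomain : Set (Level.suc (c ⊔ ℓ))
  IsDedekindDomain = IsIntegralDomain × IsNoetherian × IsIntegrallyClosed ×
                     (∀ P → IsPrimeIdeal P → NonzeroIdeal P → IsMaximalIdeal P)

  -- product of a list of ideals: the ideal generated by all products q₁⋯qₖ, qⱼ ∈ Qⱼ
  Mono : List Ideal → Carrier → Set (c ⊔ ℓ)
  Mono []       x = Lift (c ⊔ ℓ) (x ≈ 1#)
  Mono (Q ∷ Qs) x = Σ Carrier λ y → Σ Carrier λ z → mem Q y × Mono Qs z × x ≈ y * z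

  sumL : List Carrier → Carrier
  sumL = foldr _+_ 0#

  Span : (Carrier → Set (c ⊔ ℓ)) → Carrier → Set (c ⊔ ℓ)
  Span S x = Σ (List (Carrier × Carrier)) λ l →
               All (λ p → S (proj₂ p)) l × x ≈ sumL (map (λ p → proj₁ p * proj₂ p) l)

  ProdIdealMem : List Ideal → Carrier → Set (c ⊔ ℓ)
  ProdIdealMem Qs = Span (Mono Qs)

  factorList : (t : ℕ) → (Fin t → Ideal) → (Fin t → ℕ) → List Ideal
  factorList t P α = concatMap (λ i → replicate (α i) (P i)) (List.allFin t)

  record FiniteQuotient (I : Ideal) : Set (c ⊔ ℓ) where
    field
      size    : ℕ
      rep     : Fin size → Carrier
      cls     : Carrier → Fin size
      cls-rep : ∀ i → cls (rep i) ≡ i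
      cls-spec : ∀ x y → mem I (x - y) ⇔ (cls x ≡ cls y)

  open FiniteQuotient public

  private
    x-0≈x : ∀ x → x - 0# ≈ x
    x-0≈x x = trans (+-congˡ (GroupProps.ε⁻¹≈ε +-group)) (+-identityʳ x)

  memDec : ∀ {I} → FiniteQuotient I → ∀ x → Dec (mem I x)
  memDec {I} Q x with cls Q x ≟F cls Q 0#
  ... | yes eq = yes (mem-resp I (x-0≈x x) (Equivalence.from (cls-spec Q x 0#) eq))
    where open Function.Bundles using (Equivalence)
  ... | no neq = no (λ m → neq (Equivalence.to (cls-spec Q x 0#) (mem-resp I (sym (x-0≈x x)) m)))
    where open Function.Bundles using (Equivalence)

  ε : ∀ {P} → FiniteQuotient P → Carrier → ℕ
  ε Q s = εDec (memDec Q s)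

  IsUnitMod : Ideal → Carrier → Set (c ⊔ ℓ)
  IsUnitMod I x = Σ Carrier λ y → mem I (x * y - 1#)

  -- adjacency in the unitary Cayley graph G_{R/I}
  Adjacent : Ideal → Carrier → Carrier → Set (c ⊔ ℓ)
  Adjacent I u v = IsUnitMod I (u - v)

  CommonNeighbour : (I : Ideal) → (Q : FiniteQuotient I) → Carrier → Carrier → Fin (size Q) → Set (c ⊔ ℓ)
  CommonNeighbour I Q a b v = Adjacent I a (rep Q v) × Adjacent I b (rep Q v)

-- Since I = ∏ Pᵢ^αᵢ with every Pᵢ maximal, x + I is a unit of R/I exactly when x lies in no Pᵢ,
-- so v + I is a common neighbour of a + I and b + I iff, for every i, the residue of v modulo Pᵢ
-- differs from those of a and of b; these two residues coincide exactly when a − b ∈ Pᵢ.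
-- By the Chinese remainder theorem R → ∏ R/Pᵢ is onto, and translations of R/I carry any fibre
-- of R/I → ∏ R/Pᵢ onto any other, so all fibres have the same size K = |R/I| / ∏ |R/Pᵢ|.
-- Counting tuples of residues then gives K ∏ (|R/Pᵢ| − ε(Pᵢ, a − b)) common neighbours.
module Submission where

open import Algebra.Bundles using (CommutativeRing)

module Counting where

  open import Data.Bool.Base using (Bool; true; false; if_then_else_)
  open import Data.Fin.Base using (Fin; zero; suc)
  open import Data.Fin.Permutation using (Permutation; _⟨$⟩ʳ_)
  open import Data.Fin.Properties using () renaming (_≟_ to _≟ᶠ_)
  open import Data.Fin.Subset using (Subset; _∈_; ∣_∣)
  open import Data.Nat.Base using (ℕ; zero; suc; _+_; _*_; _∸_; _≤_; z≤n; s≤s)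
  open import Data.Nat.Properties
  open import Algebra.Properties.CommutativeSemigroup *-commutativeSemigroup
    using () renaming (interchange to *-interchange)
  open import Algebra.Properties.Semiring.Sum +-*-semiring
    using (sum; sum-cong-≗; sum-replicate-zero; ∑-distrib-+; ∑-comm; sum-permute; *-distribˡ-sum; *-distribʳ-sum)
  open import Data.Product using (_×_; _,_)
  open import Data.Vec.Base using (tabulate)
  open import Data.Vec.Properties using (lookup∘tabulate; lookup⇒[]=; []=⇒lookup)
  open import Function.Base using (_∘_)
  open import Function.Bundles using (_⇔_; mk⇔; Equivalence)
  open import Function.Properties.Equivalence using () renaming (trans to ⇔-trans)
  open import Relation.Nullary using (Dec; yes; no; does; contradiction)
  open import Relation.Nullary.Decidable using (dec-true)
  open import Relation.Unary using (Pred; Decidable)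
  open import Relation.Binary.PropositionalEquality

  open import Defs using (prodFin; εDec)

  open ≡-Reasoning
  open Equivalence using (to; from)

  sum-const-1 : ∀ n → sum {n} (λ _ → 1) ≡ n
  sum-const-1 zero    = refl
  sum-const-1 (suc n) = cong suc (sum-const-1 n)

  δ : ∀ {n} → Fin n → Fin n → ℕ
  δ zero    zero    = 1
  δ zero    (suc y) = 0
  δ (suc x) zero    = 0
  δ (suc x) (suc y) = δ x y

  δᶜ : ∀ {n} → Fin n → Fin n → ℕ
  δᶜ zero    zero    = 0
  δᶜ zero    (suc y) = 1
  δᶜ (suc x) zero    = 1
  δᶜ (suc x) (suc y) = δᶜ x y

  δ-refl : ∀ {n} (x : Fin n) → δ x x ≡ 1
  δ-refl zero    = refl
  δ-refl (suc x) = δ-refl x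

  δ-≢ : ∀ {n} {x y : Fin n} → x ≢ y → δ x y ≡ 0
  δ-≢ {x = zero}  {zero}  x≢y = contradiction refl x≢y
  δ-≢ {x = zero}  {suc y} x≢y = refl
  δ-≢ {x = suc x} {zero}  x≢y = refl
  δ-≢ {x = suc x} {suc y} x≢y = δ-≢ (x≢y ∘ cong suc)

  δ-cong-⇔ : ∀ {m n} {x y : Fin m} {x′ y′ : Fin n} → (x ≡ y ⇔ x′ ≡ y′) → δ x y ≡ δ x′ y′
  δ-cong-⇔ {x = x} {y} {x′} {y′} x≡y⇔x′≡y′ with x ≟ᶠ y | x′ ≟ᶠ y′
  ... | yes refl | yes refl = trans (δ-refl x) (sym (δ-refl x′))
  ... | yes x≡y  | no x′≢y′ = contradiction (to x≡y⇔x′≡y′ x≡y) x′≢y′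
  ... | no x≢y   | yes x′≡y′ = contradiction (from x≡y⇔x′≡y′ x′≡y′) x≢y
  ... | no x≢y   | no x′≢y′ = trans (δ-≢ x≢y) (sym (δ-≢ x′≢y′))

  δᶜ+δ≡1 : ∀ {n} (x y : Fin n) → δᶜ x y + δ x y ≡ 1
  δᶜ+δ≡1 zero    zero    = refl
  δᶜ+δ≡1 zero    (suc y) = refl
  δᶜ+δ≡1 (suc x) zero    = refl
  δᶜ+δ≡1 (suc x) (suc y) = δᶜ+δ≡1 x y

  δᶜ-refl : ∀ {n} (x : Fin n) → δᶜ x x ≡ 0
  δᶜ-refl zero    = refl
  δᶜ-refl (suc x) = δᶜ-refl x

  δᶜ≤1 : ∀ {n} (x y : Fin n) → δᶜ x y ≤ 1
  δᶜ≤1 x y = subst (δᶜ x y ≤_) (δᶜ+δ≡1 x y) (m≤m+n (δᶜ x y) (δ x y))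

  δᶜ-idem : ∀ {n} (x y : Fin n) → δᶜ x y * δᶜ x y ≡ δᶜ x y
  δᶜ-idem zero    zero    = refl
  δᶜ-idem zero    (suc y) = refl
  δᶜ-idem (suc x) zero    = refl
  δᶜ-idem (suc x) (suc y) = δᶜ-idem x y

  δᶜ≡1⇔≢ : ∀ {n} {x y : Fin n} → δᶜ x y ≡ 1 ⇔ x ≢ y
  δᶜ≡1⇔≢ {x = x} {y} = mk⇔ δᶜ≡1⇒≢ ≢⇒δᶜ≡1
    where
    δᶜ≡1⇒≢ : δᶜ x y ≡ 1 → x ≢ y
    δᶜ≡1⇒≢ δᶜ≡1 refl = 0≢1+n (trans (sym (δᶜ-refl x)) δᶜ≡1)
    ≢⇒δᶜ≡1 : x ≢ y → δᶜ x y ≡ 1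
    ≢⇒δᶜ≡1 x≢y = trans (sym (+-identityʳ _)) (trans (cong (δᶜ x y +_) (sym (δ-≢ x≢y))) (δᶜ+δ≡1 x y))

  ∑-δ : ∀ {n} (x : Fin n) (g : Fin n → ℕ) → sum (λ y → δ x y * g y) ≡ g x
  ∑-δ {suc n} zero    g = begin
    1 * g zero + sum {n} (λ y → 0 * g (suc y))  ≡⟨ cong₂ _+_ (*-identityˡ (g zero)) (sum-replicate-zero n) ⟩
    g zero + 0                                  ≡⟨ +-identityʳ (g zero) ⟩
    g zero                                      ∎
  ∑-δ {suc n} (suc x) g = ∑-δ x (g ∘ suc)

  ∑-δᶜ-* : ∀ {n} (x : Fin n) (h : Fin n → ℕ) → sum (λ y → δᶜ x y * h y) + h x ≡ sum h
  ∑-δᶜ-* {n} x h = begin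
    sum (λ y → δᶜ x y * h y) + h x                         ≡⟨ cong (sum (λ y → δᶜ x y * h y) +_) (∑-δ x h) ⟨
    sum (λ y → δᶜ x y * h y) + sum (λ y → δ x y * h y)     ≡⟨ ∑-distrib-+ (λ y → δᶜ x y * h y) (λ y → δ x y * h y) ⟨
    sum (λ y → δᶜ x y * h y + δ x y * h y)                 ≡⟨ sum-cong-≗ {n} (λ y → *-distribʳ-+ (h y) (δᶜ x y) (δ x y)) ⟨
    sum (λ y → (δᶜ x y + δ x y) * h y)                     ≡⟨ sum-cong-≗ {n} (λ y → trans (cong (_* h y) (δᶜ+δ≡1 x y)) (*-identityˡ (h y))) ⟩
    sum h                                                  ∎

  ∑-δᶜ : ∀ {n} (x : Fin n) → sum (δᶜ x) + 1 ≡ n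
  ∑-δᶜ {n} x = begin
    sum (δᶜ x) + 1                   ≡⟨ cong (_+ 1) (sum-cong-≗ {n} (λ y → *-identityʳ (δᶜ x y))) ⟨
    sum (λ y → δᶜ x y * 1) + 1       ≡⟨ ∑-δᶜ-* x (λ _ → 1) ⟩
    sum {n} (λ _ → 1)                ≡⟨ sum-const-1 n ⟩
    n                                ∎

  ∑-δᶜ-δᶜ+ε≡n : ∀ {n} (x y : Fin n) {p} {A : Set p} (a? : Dec A) → (A ⇔ x ≡ y) →
                sum (λ z → δᶜ x z * δᶜ y z) + εDec a? ≡ n
  ∑-δᶜ-δᶜ+ε≡n {n} x y (yes a) A⇔x≡y with to A⇔x≡y a
  ... | refl = begin
    sum (λ z → δᶜ x z * δᶜ x z) + 1  ≡⟨ cong (_+ 1) (sum-cong-≗ {n} (δᶜ-idem x)) ⟩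
    sum (δᶜ x) + 1                   ≡⟨ ∑-δᶜ x ⟩
    n                                ∎
  ∑-δᶜ-δᶜ+ε≡n {n} x y (no ¬a) A⇔x≡y = begin
    sum (λ z → δᶜ x z * δᶜ y z) + 2          ≡⟨ +-assoc _ 1 1 ⟨
    sum (λ z → δᶜ x z * δᶜ y z) + 1 + 1      ≡⟨ cong (λ k → sum (λ z → δᶜ x z * δᶜ y z) + k + 1) (from δᶜ≡1⇔≢ y≢x) ⟨
    sum (λ z → δᶜ x z * δᶜ y z) + δᶜ y x + 1 ≡⟨ cong (_+ 1) (∑-δᶜ-* x (δᶜ y)) ⟩
    sum (δᶜ y) + 1                           ≡⟨ ∑-δᶜ y ⟩
    n                                        ∎
    where
    y≢x : y ≢ x
    y≢x y≡x = ¬a (from A⇔x≡y (sym y≡x))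

  ∑-δᶜ-δᶜ : ∀ {n} (x y : Fin n) {p} {A : Set p} (a? : Dec A) → (A ⇔ x ≡ y) →
            sum (λ z → δᶜ x z * δᶜ y z) ≡ n ∸ εDec a?
  ∑-δᶜ-δᶜ {n} x y a? A⇔x≡y = begin
    sum (λ z → δᶜ x z * δᶜ y z)                   ≡⟨ m+n∸n≡m _ (εDec a?) ⟨
    sum (λ z → δᶜ x z * δᶜ y z) + εDec a? ∸ εDec a? ≡⟨ cong (_∸ εDec a?) (∑-δᶜ-δᶜ+ε≡n x y a? A⇔x≡y) ⟩
    n ∸ εDec a?                                   ∎

  prodFin-cong : ∀ t {f g : Fin t → ℕ} → (∀ i → f i ≡ g i) → prodFin t f ≡ prodFin t g
  prodFin-cong zero    f≗g = refl
  prodFin-cong (suc t) f≗g = cong₂ _*_ (f≗g zero) (prodFin-cong t (f≗g ∘ suc))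

  prodFin-const-1 : ∀ t → prodFin t (λ _ → 1) ≡ 1
  prodFin-const-1 zero    = refl
  prodFin-const-1 (suc t) = cong (_+ 0) (prodFin-const-1 t)

  prodFin-distrib-* : ∀ t (f g : Fin t → ℕ) →
                      prodFin t (λ i → f i * g i) ≡ prodFin t f * prodFin t g
  prodFin-distrib-* zero    f g = refl
  prodFin-distrib-* (suc t) f g = begin
    f zero * g zero * prodFin t (λ i → f (suc i) * g (suc i))
      ≡⟨ cong (f zero * g zero *_) (prodFin-distrib-* t (f ∘ suc) (g ∘ suc)) ⟩
    f zero * g zero * (prodFin t (f ∘ suc) * prodFin t (g ∘ suc))
      ≡⟨ *-interchange (f zero) (g zero) _ _ ⟩
    f zero * prodFin t (f ∘ suc) * (g zero * prodFin t (g ∘ suc))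
      ∎

  prodFin-≤1 : ∀ t (f : Fin t → ℕ) → (∀ i → f i ≤ 1) → prodFin t f ≤ 1
  prodFin-≤1 zero    f f≤1 = s≤s z≤n
  prodFin-≤1 (suc t) f f≤1 = *-mono-≤ (f≤1 zero) (prodFin-≤1 t (f ∘ suc) (f≤1 ∘ suc))

  prodFin≡1⇔ : ∀ t (f : Fin t → ℕ) → prodFin t f ≡ 1 ⇔ (∀ i → f i ≡ 1)
  prodFin≡1⇔ t f = mk⇔ (prodFin≡1⇒ t f) (⇒prodFin≡1 t f)
    where
    prodFin≡1⇒ : ∀ t (f : Fin t → ℕ) → prodFin t f ≡ 1 → ∀ i → f i ≡ 1
    prodFin≡1⇒ (suc t) f eq zero    = m*n≡1⇒m≡1 (f zero) _ eq
    prodFin≡1⇒ (suc t) f eq (suc i) = prodFin≡1⇒ t (f ∘ suc) (m*n≡1⇒n≡1 (f zero) _ eq) i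
    ⇒prodFin≡1 : ∀ t (f : Fin t → ℕ) → (∀ i → f i ≡ 1) → prodFin t f ≡ 1
    ⇒prodFin≡1 zero    f f≡1 = refl
    ⇒prodFin≡1 (suc t) f f≡1 = cong₂ _*_ (f≡1 zero) (⇒prodFin≡1 t (f ∘ suc) (f≡1 ∘ suc))

  ∈-tabulate-does : ∀ {n p} {P : Pred (Fin n) p} (P? : Decidable P) (v : Fin n) →
                    v ∈ tabulate (does ∘ P?) ⇔ P v
  ∈-tabulate-does {P = P} P? v = mk⇔ ∈⇒P (λ Pv → lookup⇒[]= v _ (trans (lookup∘tabulate _ v) (dec-true (P? v) Pv)))
    where
    ∈⇒P : v ∈ tabulate (does ∘ P?) → P v
    ∈⇒P v∈ with P? v | trans (sym (lookup∘tabulate (does ∘ P?) v)) ([]=⇒lookup v∈)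
    ... | yes Pv | _ = Pv

  ∣tabulate∣≡sum : ∀ {n} (g : Fin n → Bool) → ∣ tabulate g ∣ ≡ sum (λ v → if g v then 1 else 0)
  ∣tabulate∣≡sum {zero}  g = refl
  ∣tabulate∣≡sum {suc n} g with g zero
  ... | true  = cong suc (∣tabulate∣≡sum (g ∘ suc))
  ... | false = ∣tabulate∣≡sum (g ∘ suc)

  Tuple : ∀ {t} → (Fin t → ℕ) → Set
  Tuple {t} p = (i : Fin t) → Fin (p i)

  _◂_ : ∀ {t} {p : Fin (suc t) → ℕ} → Fin (p zero) → Tuple (p ∘ suc) → Tuple p
  (x ◂ u) zero    = x
  (x ◂ u) (suc i) = u i

  sumᵀ : ∀ {t} (p : Fin t → ℕ) → (Tuple p → ℕ) → ℕ
  sumᵀ {zero}  p F = F (λ ())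
  sumᵀ {suc t} p F = sum (λ x → sumᵀ (p ∘ suc) (λ u → F (x ◂ u)))

  sumᵀ-cong : ∀ {t} (p : Fin t → ℕ) {F G : Tuple p → ℕ} → (∀ u → F u ≡ G u) → sumᵀ p F ≡ sumᵀ p G
  sumᵀ-cong {zero}  p F≗G = F≗G _
  sumᵀ-cong {suc t} p F≗G = sum-cong-≗ {p zero} (λ x → sumᵀ-cong (p ∘ suc) (λ u → F≗G (x ◂ u)))

  *-distribˡ-sumᵀ : ∀ {t} (p : Fin t → ℕ) c (F : Tuple p → ℕ) → c * sumᵀ p F ≡ sumᵀ p (λ u → c * F u)
  *-distribˡ-sumᵀ {zero}  p c F = refl
  *-distribˡ-sumᵀ {suc t} p c F = begin
    c * sum (λ x → sumᵀ (p ∘ suc) (λ u → F (x ◂ u)))     ≡⟨ *-distribˡ-sum c (λ x → sumᵀ (p ∘ suc) (λ u → F (x ◂ u))) ⟩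
    sum (λ x → c * sumᵀ (p ∘ suc) (λ u → F (x ◂ u)))     ≡⟨ sum-cong-≗ {p zero} (λ x → *-distribˡ-sumᵀ (p ∘ suc) c _) ⟩
    sum (λ x → sumᵀ (p ∘ suc) (λ u → c * F (x ◂ u)))     ∎

  sumᵀ-comm-sum : ∀ {t N} (p : Fin t → ℕ) (H : Tuple p → Fin N → ℕ) →
                  sumᵀ p (λ u → sum (H u)) ≡ sum (λ v → sumᵀ p (λ u → H u v))
  sumᵀ-comm-sum {zero}  p H = refl
  sumᵀ-comm-sum {suc t} p H = begin
    sum (λ x → sumᵀ (p ∘ suc) (λ u → sum (H (x ◂ u))))         ≡⟨ sum-cong-≗ {p zero} (λ x → sumᵀ-comm-sum (p ∘ suc) (H ∘ (x ◂_))) ⟩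
    sum (λ x → sum (λ v → sumᵀ (p ∘ suc) (λ u → H (x ◂ u) v)))  ≡⟨ ∑-comm (λ x v → sumᵀ (p ∘ suc) (λ u → H (x ◂ u) v)) ⟩
    sum (λ v → sum (λ x → sumᵀ (p ∘ suc) (λ u → H (x ◂ u) v)))  ∎

  sumᵀ-prodFin : ∀ {t} (p : Fin t → ℕ) (g : (i : Fin t) → Fin (p i) → ℕ) →
                 sumᵀ p (λ u → prodFin t (λ i → g i (u i))) ≡ prodFin t (λ i → sum (g i))
  sumᵀ-prodFin {zero}  p g = refl
  sumᵀ-prodFin {suc t} p g = begin
    sum (λ x → sumᵀ (p ∘ suc) (λ u → g zero x * prodFin t (λ i → g (suc i) (u i))))
      ≡⟨ sum-cong-≗ {p zero} (λ x → *-distribˡ-sumᵀ (p ∘ suc) (g zero x) _) ⟨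
    sum (λ x → g zero x * sumᵀ (p ∘ suc) (λ u → prodFin t (λ i → g (suc i) (u i))))
      ≡⟨ *-distribʳ-sum (sumᵀ (p ∘ suc) (λ u → prodFin t (λ i → g (suc i) (u i)))) (g zero) ⟨
    sum (g zero) * sumᵀ (p ∘ suc) (λ u → prodFin t (λ i → g (suc i) (u i)))
      ≡⟨ cong (sum (g zero) *_) (sumᵀ-prodFin (p ∘ suc) (g ∘ suc)) ⟩
    sum (g zero) * prodFin t (λ i → sum (g (suc i)))
      ∎

  module _ {N t} {p : Fin t → ℕ} (φ : Fin N → Tuple p) where

    -- ∏ᵢ δ (φ v i) (u i) is the indicator of φ v = u, compared coordinatewise.
    fibreSize : Tuple p → ℕ
    fibreSize u = sum (λ v → prodFin t (λ i → δ (φ v i) (u i)))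

    sum-by-fibres : (g : (i : Fin t) → Fin (p i) → ℕ) →
                    sum (λ v → prodFin t (λ i → g i (φ v i))) ≡
                    sumᵀ p (λ u → fibreSize u * prodFin t (λ i → g i (u i)))
    sum-by-fibres g = begin
      sum (λ v → prodFin t (λ i → g i (φ v i)))
        ≡⟨ sum-cong-≗ {N} (λ v → prodFin-cong t (λ i → ∑-δ (φ v i) (g i))) ⟨
      sum (λ v → prodFin t (λ i → sum (λ x → δ (φ v i) x * g i x)))
        ≡⟨ sum-cong-≗ {N} (λ v → sumᵀ-prodFin p (λ i x → δ (φ v i) x * g i x)) ⟨
      sum (λ v → sumᵀ p (λ u → prodFin t (λ i → δ (φ v i) (u i) * g i (u i))))
        ≡⟨ sumᵀ-comm-sum p (λ u v → prodFin t (λ i → δ (φ v i) (u i) * g i (u i))) ⟨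
      sumᵀ p (λ u → sum (λ v → prodFin t (λ i → δ (φ v i) (u i) * g i (u i))))
        ≡⟨ sumᵀ-cong p (λ u → sum-cong-≗ {N} (λ v → prodFin-distrib-* t _ _)) ⟩
      sumᵀ p (λ u → sum (λ v → prodFin t (λ i → δ (φ v i) (u i)) * prodFin t (λ i → g i (u i))))
        ≡⟨ sumᵀ-cong p (λ u → *-distribʳ-sum (prodFin t (λ i → g i (u i))) (λ v → prodFin t (λ i → δ (φ v i) (u i)))) ⟨
      sumᵀ p (λ u → fibreSize u * prodFin t (λ i → g i (u i)))
        ∎

    fibreSize-permute : ∀ u u′ (π : Permutation N N) →
                        (∀ v i → φ (π ⟨$⟩ʳ v) i ≡ u′ i ⇔ φ v i ≡ u i) →
                        fibreSize u ≡ fibreSize u′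
    fibreSize-permute u u′ π φπ≡u′⇔φ≡u = begin
      fibreSize u
        ≡⟨ sum-cong-≗ {N} (λ v → prodFin-cong t (λ i → δ-cong-⇔ (φπ≡u′⇔φ≡u v i))) ⟨
      sum (λ v → prodFin t (λ i → δ (φ (π ⟨$⟩ʳ v) i) (u′ i)))
        ≡⟨ sum-permute (λ v → prodFin t (λ i → δ (φ v i) (u′ i))) π ⟨
      fibreSize u′
        ∎

    sum-uniform-fibres : ∀ K → (∀ u → fibreSize u ≡ K) → (g : (i : Fin t) → Fin (p i) → ℕ) →
                         sum (λ v → prodFin t (λ i → g i (φ v i))) ≡ K * prodFin t (λ i → sum (g i))
    sum-uniform-fibres K fibreSize≡K g = begin
      sum (λ v → prodFin t (λ i → g i (φ v i)))
        ≡⟨ sum-by-fibres g ⟩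
      sumᵀ p (λ u → fibreSize u * prodFin t (λ i → g i (u i)))
        ≡⟨ sumᵀ-cong p (λ u → cong (_* prodFin t (λ i → g i (u i))) (fibreSize≡K u)) ⟩
      sumᵀ p (λ u → K * prodFin t (λ i → g i (u i)))
        ≡⟨ *-distribˡ-sumᵀ p K _ ⟨
      K * sumᵀ p (λ u → prodFin t (λ i → g i (u i)))
        ≡⟨ cong (K *_) (sumᵀ-prodFin p g) ⟩
      K * prodFin t (λ i → sum (g i))
        ∎

  δᶜ*δᶜ≡1⇔ : ∀ {n} {x y z : Fin n} → δᶜ x z * δᶜ y z ≡ 1 ⇔ (x ≢ z × y ≢ z)
  δᶜ*δᶜ≡1⇔ {x = x} {y} {z} = mk⇔
    (λ eq → to δᶜ≡1⇔≢ (m*n≡1⇒m≡1 (δᶜ x z) (δᶜ y z) eq) , to δᶜ≡1⇔≢ (m*n≡1⇒n≡1 (δᶜ x z) (δᶜ y z) eq))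
    (λ (x≢z , y≢z) → cong₂ _*_ (from δᶜ≡1⇔≢ x≢z) (from δᶜ≡1⇔≢ y≢z))

  card-uniform-fibres : ∀ {N t} {p : Fin t → ℕ} (φ : Fin N → Tuple p) K →
                        (∀ u → fibreSize φ u ≡ K) → N ≡ K * prodFin t p
  card-uniform-fibres {N} {t} {p} φ K fibres = begin
    N                                                  ≡⟨ sum-const-1 N ⟨
    sum {N} (λ _ → 1)                                  ≡⟨ sum-cong-≗ {N} (λ _ → prodFin-const-1 t) ⟨
    sum {N} (λ v → prodFin t (λ i → 1))                ≡⟨ sum-uniform-fibres φ K fibres (λ _ _ → 1) ⟩
    K * prodFin t (λ i → sum {p i} (λ _ → 1))          ≡⟨ cong (K *_) (prodFin-cong t (λ i → sum-const-1 (p i))) ⟩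
    K * prodFin t p                                    ∎

  module _ {N t} {p : Fin t → ℕ} (φ : Fin N → Tuple p) (x y : Tuple p) where

    avoidance : Fin N → ℕ
    avoidance v = prodFin t (λ i → δᶜ (x i) (φ v i) * δᶜ (y i) (φ v i))

    avoiding : Subset N
    avoiding = tabulate (λ v → does (avoidance v ≟ 1))

    ∈-avoiding⇔ : ∀ v → v ∈ avoiding ⇔ (∀ i → x i ≢ φ v i × y i ≢ φ v i)
    ∈-avoiding⇔ v = ⇔-trans (∈-tabulate-does (λ v → avoidance v ≟ 1) v)
                   (⇔-trans (prodFin≡1⇔ t _) (mk⇔ (λ h i → to δᶜ*δᶜ≡1⇔ (h i)) (λ h i → from δᶜ*δᶜ≡1⇔ (h i))))

    ∣avoiding∣ : ∀ K → (∀ u → fibreSize φ u ≡ K) →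
                 ∣ avoiding ∣ ≡ K * prodFin t (λ i → sum (λ z → δᶜ (x i) z * δᶜ (y i) z))
    ∣avoiding∣ K fibres = begin
      ∣ avoiding ∣                                          ≡⟨ ∣tabulate∣≡sum (λ v → does (avoidance v ≟ 1)) ⟩
      sum {N} (λ v → if does (avoidance v ≟ 1) then 1 else 0)  ≡⟨ sum-cong-≗ {N} (λ v → indicator-≟1 (avoidance≤1 v)) ⟩
      sum avoidance                                         ≡⟨ sum-uniform-fibres φ K fibres _ ⟩
      K * prodFin t (λ i → sum (λ z → δᶜ (x i) z * δᶜ (y i) z)) ∎
      where
      avoidance≤1 : ∀ v → avoidance v ≤ 1
      avoidance≤1 v = prodFin-≤1 t _ (λ i → *-mono-≤ (δᶜ≤1 (x i) (φ v i)) (δᶜ≤1 (y i) (φ v i)))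
      indicator-≟1 : ∀ {m} → m ≤ 1 → (if does (m ≟ 1) then 1 else 0) ≡ m
      indicator-≟1 z≤n       = refl
      indicator-≟1 (s≤s z≤n) = refl

module IdealTheory {c ℓ} (R : CommutativeRing c ℓ) where

  open import Level using (_⊔_; lift)
  open import Data.Empty using (⊥-elim)
  open import Data.Nat.Base using (ℕ; zero; suc; _≤_)
  open import Data.Fin.Base using (Fin; zero; suc)
  open import Data.Product using (Σ; _×_; _,_; proj₁; proj₂)
  open import Data.Sum using (inj₁; inj₂)
  open import Data.List.Base using (List; []; _∷_; map; replicate)
  open import Data.List.Membership.Propositional using (_∈_)
  open import Data.List.Membership.Propositional.Properties using (∈-concat⁺′; ∈-map⁺; ∈-allFin)
  open import Data.List.Relation.Unary.Any using (here; there)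
  open import Data.List.Relation.Unary.All using (All; []; _∷_)
  open import Data.List.Relation.Unary.All.Properties using (concat⁺; map⁺; tabulate⁺; replicate⁺)
  import Relation.Binary.PropositionalEquality as ≡
  open ≡ using (_≢_)
  open import Data.Fin.Properties using (suc-injective) renaming (_≟_ to _≟ᶠ_)
  open import Function.Base using (_∘_)
  open import Function.Bundles using (_⇔_; mk⇔; Equivalence)
  open import Relation.Nullary using (¬_; yes; no)
  open import Algebra.Properties.Ring (CommutativeRing.ring R) using (-1*x≈-x; -‿distribˡ-*; -‿distribʳ-*)
  open import Algebra.Properties.AbelianGroup (CommutativeRing.+-abelianGroup R) using (⁻¹-anti-homo‿-; ⁻¹-∙-comm)
  open import Algebra.Properties.Group (CommutativeRing.+-group R) using (ε⁻¹≈ε)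
  open import Algebra.Properties.CommutativeSemigroup (CommutativeRing.+-commutativeSemigroup R)
    using () renaming (interchange to +-interchange)
  open import Algebra.Properties.CommutativeSemigroup (CommutativeRing.*-commutativeSemigroup R)
    using (x∙yz≈y∙xz)
  open import Data.Fin.Permutation using (Permutation; permutation; _⟨$⟩ʳ_)
  open import Defs
  open Counting using (Tuple; fibreSize; fibreSize-permute)

  open CommutativeRing R hiding (zero)
  open import Relation.Binary.Reasoning.Setoid setoid
  open import Algebra.Definitions.RawMonoid +-rawMonoid using (sum)
  open import Algebra.Definitions.RawMonoid *-rawMonoid using () renaming (sum to product)

  infix 4 _≈_mod_

  _≈_mod_ : Carrier → Carrier → Ideal R → Set (c ⊔ ℓ)
  x ≈ y mod I = mem I (x - y)

  x-0≈x : ∀ x → x - 0# ≈ x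
  x-0≈x x = trans (+-congˡ ε⁻¹≈ε) (+-identityʳ x)

  module _ (I : Ideal R) where

    mem-neg : ∀ {x} → mem I x → mem I (- x)
    mem-neg {x} x∈I = mem-resp I (-1*x≈-x x) (mem-* I (- 1#) x∈I)

    mem-*ʳ : ∀ {x} y → mem I x → mem I (x * y)
    mem-*ʳ {x} y x∈I = mem-resp I (*-comm y x) (mem-* I y x∈I)

    ≈⇒≈mod : ∀ {x y} → x ≈ y → x ≈ y mod I
    ≈⇒≈mod {x} {y} x≈y = mem-resp I (sym (trans (+-congʳ x≈y) (-‿inverseʳ y))) (mem-0 I)

    mod-refl : ∀ {x} → x ≈ x mod I
    mod-refl = ≈⇒≈mod refl

    mod-sym : ∀ {x y} → x ≈ y mod I → y ≈ x mod I
    mod-sym {x} {y} x≈y = mem-resp I (⁻¹-anti-homo‿- x y) (mem-neg x≈y)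

    mod-trans : ∀ {x y z} → x ≈ y mod I → y ≈ z mod I → x ≈ z mod I
    mod-trans {x} {y} {z} x≈y y≈z = mem-resp I telescope (mem-+ I x≈y y≈z)
      where
      telescope : (x - y) + (y - z) ≈ x - z
      telescope = begin
        (x - y) + (y - z)    ≈⟨ +-assoc x (- y) (y - z) ⟩
        x + (- y + (y - z))  ≈⟨ +-congˡ (+-assoc (- y) y (- z)) ⟨
        x + ((- y + y) - z)  ≈⟨ +-congˡ (+-congʳ (-‿inverseˡ y)) ⟩
        x + (0# - z)         ≈⟨ +-congˡ (+-identityˡ (- z)) ⟩
        x - z                ∎

    mod-resp : ∀ {x y x′ y′} → x ≈ x′ → y ≈ y′ → x ≈ y mod I → x′ ≈ y′ mod I
    mod-resp x≈x′ y≈y′ x≈y = mod-trans (≈⇒≈mod (sym x≈x′)) (mod-trans x≈y (≈⇒≈mod y≈y′))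

    +-cong-mod : ∀ {x y x′ y′} → x ≈ x′ mod I → y ≈ y′ mod I → x + y ≈ x′ + y′ mod I
    +-cong-mod {x} {y} {x′} {y′} x≈x′ y≈y′ = mem-resp I regroup (mem-+ I x≈x′ y≈y′)
      where
      regroup : (x - x′) + (y - y′) ≈ (x + y) - (x′ + y′)
      regroup = trans (+-interchange x (- x′) y (- y′)) (+-congˡ (⁻¹-∙-comm x′ y′))

    neg-cong-mod : ∀ {x y} → x ≈ y mod I → - x ≈ - y mod I
    neg-cong-mod {x} {y} x≈y = mem-resp I (sym (⁻¹-∙-comm x (- y))) (mem-neg x≈y)

    *-cong-mod : ∀ {x y x′ y′} → x ≈ x′ mod I → y ≈ y′ mod I → x * y ≈ x′ * y′ mod I
    *-cong-mod {x} {y} {x′} {y′} x≈x′ y≈y′ =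
      mod-trans {y = x′ * y} (mem-resp I distribute-left (mem-*ʳ y x≈x′))
                             (mem-resp I distribute-right (mem-* I x′ y≈y′))
      where
      distribute-left : (x - x′) * y ≈ x * y - x′ * y
      distribute-left = trans (distribʳ y x (- x′)) (+-congˡ (sym (-‿distribˡ-* x′ y)))
      distribute-right : x′ * (y - y′) ≈ x′ * y - x′ * y′
      distribute-right = trans (distribˡ x′ y (- y′)) (+-congˡ (sym (-‿distribʳ-* x′ y′)))

    mem⇔≈0mod : ∀ {x} → mem I x ⇔ x ≈ 0# mod I
    mem⇔≈0mod {x} = mk⇔ (mem-resp I (sym (x-0≈x x))) (mem-resp I (x-0≈x x))

  _+ᴵ_ : Ideal R → Ideal R → Ideal R
  I +ᴵ J = record
    { mem      = λ z → Σ Carrier λ x → Σ Carrier λ y → mem I x × mem J y × z ≈ x + y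
    ; mem-resp = λ { z≈z′ (x , y , x∈I , y∈J , z≈x+y) → x , y , x∈I , y∈J , trans (sym z≈z′) z≈x+y }
    ; mem-0    = 0# , 0# , mem-0 I , mem-0 J , sym (+-identityʳ 0#)
    ; mem-+    = λ { (x , y , x∈I , y∈J , z≈x+y) (x′ , y′ , x′∈I , y′∈J , z′≈x′+y′) →
                     x + x′ , y + y′ , mem-+ I x∈I x′∈I , mem-+ J y∈J y′∈J ,
                     trans (+-cong z≈x+y z′≈x′+y′) (+-interchange x y x′ y′) }
    ; mem-*    = λ { r (x , y , x∈I , y∈J , z≈x+y) →
                     r * x , r * y , mem-* I r x∈I , mem-* J r y∈J , trans (*-congˡ z≈x+y) (distribˡ r x y) }
    }

  ⟨_⟩ : Carrier → Ideal R
  ⟨ x ⟩ = record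
    { mem      = λ z → Σ Carrier λ r → z ≈ x * r
    ; mem-resp = λ { z≈z′ (r , z≈xr) → r , trans (sym z≈z′) z≈xr }
    ; mem-0    = 0# , sym (zeroʳ x)
    ; mem-+    = λ { (r , z≈xr) (r′ , z′≈xr′) → r + r′ , trans (+-cong z≈xr z′≈xr′) (sym (distribˡ x r r′)) }
    ; mem-*    = λ { s (r , z≈xr) → s * r , trans (*-congˡ z≈xr) (x∙yz≈y∙xz s x r) }
    }

  maximal⇒comaximal : ∀ {M J} → IsMaximalIdeal R M → ¬ (_⊆I_ R J M) →
                      Σ Carrier λ j → mem J j × j ≈ 1# mod M
  maximal⇒comaximal {M} {J} (1∉M , maximal) J⊈M with maximal (M +ᴵ J) M⊆M+J
    where
    M⊆M+J : _⊆I_ R M (M +ᴵ J)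
    M⊆M+J m m∈M = m , 0# , m∈M , mem-0 J , sym (+-identityʳ m)
  ... | inj₁ M+J⊆M = ⊥-elim (J⊈M (λ j j∈J → M+J⊆M j (0# , j , mem-0 M , j∈J , sym (+-identityˡ j))))
  ... | inj₂ (m , j , m∈M , j∈J , 1≈m+j) =
    j , j∈J , mod-sym M (mod-resp M (sym 1≈m+j) (+-identityˡ j)
                           (+-cong-mod M (Equivalence.to (mem⇔≈0mod M) m∈M) (mod-refl M)))

  maximal⇒IsUnitMod : ∀ {M x} → IsMaximalIdeal R M → ¬ mem M x → IsUnitMod R M x
  maximal⇒IsUnitMod {M} {x} M-maximal x∉M with maximal⇒comaximal {M} {⟨ x ⟩} M-maximal ⟨x⟩⊈M
    where
    ⟨x⟩⊈M : ¬ (_⊆I_ R ⟨ x ⟩ M)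
    ⟨x⟩⊈M ⟨x⟩⊆M = x∉M (⟨x⟩⊆M x (1# , sym (*-identityʳ x)))
  ... | (j , (r , j≈xr) , j≈1) = r , mod-resp M j≈xr refl j≈1

  distinct-maximal⇒comaximal : ∀ {M N} → IsMaximalIdeal R M → IsMaximalIdeal R N → ¬ SameIdeal R M N →
                               Σ Carrier λ b → mem N b × b ≈ 1# mod M
  distinct-maximal⇒comaximal {M} {N} M-maximal (_ , N-maximal) M≉N = maximal⇒comaximal {M} {N} M-maximal N⊈M
    where
    N⊈M : ¬ (_⊆I_ R N M)
    N⊈M N⊆M with N-maximal M N⊆M
    ... | inj₁ M⊆N = M≉N (M⊆N , N⊆M)
    ... | inj₂ 1∈M = proj₁ M-maximal 1∈M

  IsUnitMod⇒∉ : ∀ {P x} → ¬ mem P 1# → IsUnitMod R P x → ¬ mem P x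
  IsUnitMod⇒∉ {P} {x} 1∉P (y , xy≈1) x∈P =
    1∉P (Equivalence.from (mem⇔≈0mod P) (mod-trans P (mod-sym P xy≈1) xy≈0))
    where
    xy≈0 : x * y ≈ 0# mod P
    xy≈0 = Equivalence.to (mem⇔≈0mod P) (mem-*ʳ P y x∈P)

  IsUnitMod-⊆ : ∀ {I J x} → _⊆I_ R I J → IsUnitMod R I x → IsUnitMod R J x
  IsUnitMod-⊆ I⊆J (y , xy≈1) = y , I⊆J _ xy≈1

  mem-Mono : ∀ {Q} L {z} → Q ∈ L → Mono R L z → mem Q z
  mem-Mono {Q} (Q ∷ L) (here ≡.refl) (y , z′ , y∈Q , _ , z≈yz′) =
    mem-resp Q (sym z≈yz′) (mem-*ʳ Q z′ y∈Q)
  mem-Mono {Q} (_ ∷ L) (there Q∈L) (y , z′ , _ , z′∈∏L , z≈yz′) =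
    mem-resp Q (sym z≈yz′) (mem-* Q y (mem-Mono L Q∈L z′∈∏L))

  mem-ProdIdealMem : ∀ {Q} L {z} → Q ∈ L → ProdIdealMem R L z → mem Q z
  mem-ProdIdealMem {Q} L Q∈L (terms , monomials , z≈∑) = mem-resp Q (sym z≈∑) (mem-sum terms monomials)
    where
    mem-sum : ∀ terms → All (λ term → Mono R L (proj₂ term)) terms →
              mem Q (sumL R (map (λ term → proj₁ term * proj₂ term) terms))
    mem-sum []                  []       = mem-0 Q
    mem-sum ((r , m) ∷ terms) (m∈∏L ∷ ms) = mem-+ Q (mem-* Q r (mem-Mono L Q∈L m∈∏L)) (mem-sum terms ms)

  Mono⇒ProdIdealMem : ∀ L {z} → Mono R L z → ProdIdealMem R L z
  Mono⇒ProdIdealMem L {z} z∈∏L = (1# , z) ∷ [] , z∈∏L ∷ [] , sym (trans (+-identityʳ (1# * z)) (*-identityˡ z))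

  -- Each factor Q contains 1 − x y ≡ 1 mod ⟨ x ⟩, and the product of these stays ≡ 1 mod ⟨ x ⟩.
  unit-factors⇒Mono≈1 : ∀ {x} L → All (λ Q → IsUnitMod R Q x) L →
                         Σ Carrier λ z → Mono R L z × z ≈ 1# mod ⟨ x ⟩
  unit-factors⇒Mono≈1         []      []                  = 1# , lift refl , mod-refl ⟨ _ ⟩
  unit-factors⇒Mono≈1 {x} (Q ∷ L) ((y , xy≈1) ∷ units) with unit-factors⇒Mono≈1 L units
  ... | z , z∈∏L , z≈1 =
    (1# - x * y) * z , (1# - x * y , z , mod-sym Q xy≈1 , z∈∏L , refl) ,
    mod-resp ⟨ x ⟩ refl (*-identityʳ 1#) (*-cong-mod ⟨ x ⟩ 1-xy≈1 z≈1)
    where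
    1-xy≈1 : 1# - x * y ≈ 1# mod ⟨ x ⟩
    1-xy≈1 = mod-resp ⟨ x ⟩ refl (x-0≈x 1#)
               (+-cong-mod ⟨ x ⟩ (mod-refl ⟨ x ⟩)
                 (neg-cong-mod ⟨ x ⟩ (Equivalence.to (mem⇔≈0mod ⟨ x ⟩) (y , refl))))

  IsUnitMod-from-factors : ∀ {I x} L → (∀ z → ProdIdealMem R L z → mem I z) →
                           All (λ Q → IsUnitMod R Q x) L → IsUnitMod R I x
  IsUnitMod-from-factors {I} {x} L ∏L⊆I units with unit-factors⇒Mono≈1 L units
  ... | z , z∈∏L , (w , z-1≈xw) = - w , mod-resp I (-‿distribʳ-* x w) -[0-1]≈1 (neg-cong-mod I xw≈0-1)
    where
    z≈0 : z ≈ 0# mod I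
    z≈0 = Equivalence.to (mem⇔≈0mod I) (∏L⊆I z (Mono⇒ProdIdealMem L z∈∏L))
    xw≈0-1 : x * w ≈ 0# - 1# mod I
    xw≈0-1 = mod-resp I z-1≈xw refl (+-cong-mod I z≈0 (mod-refl I))
    -[0-1]≈1 : - (0# - 1#) ≈ 1#
    -[0-1]≈1 = trans (⁻¹-anti-homo‿- 0# 1#) (x-0≈x 1#)

  module _ (I : Ideal R) where

    product≈1-mod : ∀ {n} (f : Fin n → Carrier) → (∀ j → f j ≈ 1# mod I) → product f ≈ 1# mod I
    product≈1-mod {zero}  f f≈1 = mod-refl I
    product≈1-mod {suc n} f f≈1 =
      mod-resp I refl (*-identityʳ 1#) (*-cong-mod I (f≈1 zero) (product≈1-mod (f ∘ suc) (f≈1 ∘ suc)))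

    mem-product : ∀ {n} (f : Fin n → Carrier) j → mem I (f j) → mem I (product f)
    mem-product {suc n} f zero    fj∈I = mem-*ʳ I _ fj∈I
    mem-product {suc n} f (suc j) fj∈I = mem-* I (f zero) (mem-product (f ∘ suc) j fj∈I)

    sum≈0-mod : ∀ {n} (f : Fin n → Carrier) → (∀ j → f j ≈ 0# mod I) → sum f ≈ 0# mod I
    sum≈0-mod {zero}  f f≈0 = mod-refl I
    sum≈0-mod {suc n} f f≈0 =
      mod-resp I refl (+-identityʳ 0#) (+-cong-mod I (f≈0 zero) (sum≈0-mod (f ∘ suc) (f≈0 ∘ suc)))

    sum≈term-mod : ∀ {n} (f : Fin n → Carrier) i → (∀ j → j ≢ i → f j ≈ 0# mod I) → sum f ≈ f i mod I
    sum≈term-mod {suc n} f zero    others≈0 =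
      mod-resp I refl (+-identityʳ (f zero))
        (+-cong-mod I (mod-refl I) (sum≈0-mod (f ∘ suc) (λ j → others≈0 (suc j) (λ ()))))
    sum≈term-mod {suc n} f (suc i) others≈0 =
      mod-resp I refl (+-identityˡ (f (suc i)))
        (+-cong-mod I (others≈0 zero (λ ())) (sum≈term-mod (f ∘ suc) i (λ j j≢i → others≈0 (suc j) (j≢i ∘ suc-injective))))

  chinese-remainder : ∀ {t} (P : Fin t → Ideal R) →
                      (∀ i j → i ≢ j → Σ Carrier λ b → mem (P j) b × b ≈ 1# mod P i) →
                      (r : Fin t → Carrier) → Σ Carrier λ x → ∀ i → x ≈ r i mod P i
  chinese-remainder {t} P comaximal r = sum (λ j → r j * e j) , λ i →
    mod-trans (P i) (sum≈term-mod (P i) (λ j → r j * e j) i (λ j j≢i → others≈0 i j (j≢i ∘ ≡.sym)))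
                    (mod-resp (P i) refl (*-identityʳ (r i)) (*-cong-mod (P i) (mod-refl (P i)) (e≈1 i)))
    where
    factor : ∀ i j → Σ Carrier λ b → b ≈ 1# mod P i × (i ≢ j → mem (P j) b)
    factor i j with i ≟ᶠ j
    ... | yes i≡j = 1# , mod-refl (P i) , λ i≢j → ⊥-elim (i≢j i≡j)
    ... | no  i≢j = let (b , b∈Pj , b≈1) = comaximal i j i≢j in b , b≈1 , λ _ → b∈Pj
    e : Fin t → Carrier
    e i = product (λ j → proj₁ (factor i j))
    e≈1 : ∀ i → e i ≈ 1# mod P i
    e≈1 i = product≈1-mod (P i) _ (λ j → proj₁ (proj₂ (factor i j)))
    others≈0 : ∀ i j → i ≢ j → r j * e j ≈ 0# mod P i
    others≈0 i j i≢j = Equivalence.to (mem⇔≈0mod (P i))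
                         (mem-* (P i) (r j) (mem-product (P i) _ i (proj₂ (proj₂ (factor j i)) (i≢j ∘ ≡.sym))))

  module _ {I} (Q : FiniteQuotient R I) where

    cls≡⇔≈mod : ∀ {x y} → cls Q x ≡.≡ cls Q y ⇔ x ≈ y mod I
    cls≡⇔≈mod {x} {y} = mk⇔ (Equivalence.from (cls-spec Q x y)) (Equivalence.to (cls-spec Q x y))

    rep-cls : ∀ x → rep Q (cls Q x) ≈ x mod I
    rep-cls x = Equivalence.to cls≡⇔≈mod (cls-rep Q (cls Q x))

    private
      shift : Carrier → Fin (size Q) → Fin (size Q)
      shift c v = cls Q (rep Q v + c)

      shift-inverse : ∀ c d → d + c ≈ 0# → ∀ v → shift c (shift d v) ≡.≡ v
      shift-inverse c d d+c≈0 v = ≡.trans (Equivalence.from cls≡⇔≈mod shifted-back) (cls-rep Q v)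
        where
        shifted-back : rep Q (shift d v) + c ≈ rep Q v mod I
        shifted-back = mod-resp I refl (trans (+-assoc (rep Q v) d c) (trans (+-congˡ d+c≈0) (+-identityʳ (rep Q v))))
                         (+-cong-mod I (rep-cls (rep Q v + d)) (mod-refl I))

    translate : Carrier → Permutation (size Q) (size Q)
    translate c = permutation (shift c) (shift (- c)) (shift-inverse c (- c) (-‿inverseˡ c))
                                                      (shift-inverse (- c) c (-‿inverseʳ c))

    rep-translate : ∀ c v → rep Q (translate c ⟨$⟩ʳ v) ≈ rep Q v + c mod I
    rep-translate c v = rep-cls (rep Q v + c)

  module Residues {I} (Q : FiniteQuotient R I) {t} {P : Fin t → Ideal R}
                  (QP : (i : Fin t) → FiniteQuotient R (P i)) (I⊆P : ∀ i → _⊆I_ R I (P i)) where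

    residues : Fin (size Q) → Tuple (λ i → size (QP i))
    residues v i = cls (QP i) (rep Q v)

    -- If R → ∏ R/Pᵢ is onto, translating by a preimage of u carries the fibre over u onto the fibre over 0.
    residues-uniform-fibres : (∀ u → Σ Carrier λ x → ∀ i → cls (QP i) x ≡.≡ u i) →
                              ∀ u → fibreSize residues u ≡.≡ fibreSize residues (λ i → cls (QP i) 0#)
    residues-uniform-fibres onto u with onto u
    ... | x , x↦u = fibreSize-permute residues u (λ i → cls (QP i) 0#) (translate Q (- x)) (λ v i → mk⇔ (⇒ v i) (⇐ v i))
      where
      rep-translate-P : ∀ v i → rep Q (translate Q (- x) ⟨$⟩ʳ v) ≈ rep Q v - x mod P i
      rep-translate-P v i = I⊆P i _ (rep-translate Q (- x) v)
      ⇒ : ∀ v i → residues (translate Q (- x) ⟨$⟩ʳ v) i ≡.≡ cls (QP i) 0# → residues v i ≡.≡ u i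
      ⇒ v i translate-v↦0 = ≡.trans (Equivalence.from (cls≡⇔≈mod (QP i)) v≈x) (x↦u i)
        where
        v≈x : rep Q v ≈ x mod P i
        v≈x = Equivalence.from (mem⇔≈0mod (P i))
                (mod-trans (P i) (mod-sym (P i) (rep-translate-P v i)) (Equivalence.to (cls≡⇔≈mod (QP i)) translate-v↦0))
      ⇐ : ∀ v i → residues v i ≡.≡ u i → residues (translate Q (- x) ⟨$⟩ʳ v) i ≡.≡ cls (QP i) 0#
      ⇐ v i v↦u = Equivalence.from (cls≡⇔≈mod (QP i)) (mod-trans (P i) (rep-translate-P v i) v-x≈0)
        where
        v-x≈0 : rep Q v - x ≈ 0# mod P i
        v-x≈0 = Equivalence.to (mem⇔≈0mod (P i))
                  (Equivalence.to (cls≡⇔≈mod (QP i)) (≡.trans v↦u (≡.sym (x↦u i))))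

  module Factorisation (dedekind : IsDedekindDomain R) (I : Ideal R) (I≢0 : NonzeroIdeal R I)
                       {t} (P : Fin t → Ideal R) (α : Fin t → ℕ)
                       (P-prime : ∀ i → IsPrimeIdeal R (P i))
                       (P-distinct : ∀ i j → SameIdeal R (P i) (P j) → i ≡.≡ j)
                       (α≥1 : ∀ i → 1 ≤ α i)
                       (I≈∏P : ∀ x → mem I x ⇔ ProdIdealMem R (factorList R t P α) x) where

    P∈factorList : ∀ i → P i ∈ factorList R t P α
    P∈factorList i = ∈-concat⁺′ (P∈replicate (α≥1 i)) (∈-map⁺ (λ j → replicate (α j) (P j)) (∈-allFin i))
      where
      P∈replicate : ∀ {n} → 1 ≤ n → P i ∈ replicate n (P i)
      P∈replicate {suc n} _ = here ≡.refl

    All-factorList : ∀ {p} {Pr : Ideal R → Set p} → (∀ i → Pr (P i)) → All Pr (factorList R t P α)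
    All-factorList Pr-P = concat⁺ (map⁺ (tabulate⁺ (λ i → replicate⁺ (α i) (Pr-P i))))

    I⊆P : ∀ i → _⊆I_ R I (P i)
    I⊆P i x x∈I = mem-ProdIdealMem (factorList R t P α) (P∈factorList i) (Equivalence.to (I≈∏P x) x∈I)

    P-maximal : ∀ i → IsMaximalIdeal R (P i)
    P-maximal i = proj₂ (proj₂ (proj₂ dedekind)) (P i) (P-prime i) P-nonzero
      where
      P-nonzero : NonzeroIdeal R (P i)
      P-nonzero = let (z , z∈I , z≉0) = I≢0 in z , I⊆P i z z∈I , z≉0

    IsUnitMod⇔∉P : ∀ x → IsUnitMod R I x ⇔ (∀ i → ¬ mem (P i) x)
    IsUnitMod⇔∉P x = mk⇔
      (λ x-unit i → IsUnitMod⇒∉ {P i} (proj₁ (P-prime i)) (IsUnitMod-⊆ {I} {P i} (I⊆P i) x-unit))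
      (λ x∉P → IsUnitMod-from-factors {I} (factorList R t P α) (λ z → Equivalence.from (I≈∏P z))
                 (All-factorList (λ i → maximal⇒IsUnitMod {P i} (P-maximal i) (x∉P i))))

    residue-classes-onto : (QP : (i : Fin t) → FiniteQuotient R (P i)) →
                           (u : Tuple (λ i → size (QP i))) → Σ Carrier λ x → ∀ i → cls (QP i) x ≡.≡ u i
    residue-classes-onto QP u with chinese-remainder P comaximal (λ i → rep (QP i) (u i))
      where
      comaximal : ∀ i j → i ≢ j → Σ Carrier λ b → mem (P j) b × b ≈ 1# mod P i
      comaximal i j i≢j = distinct-maximal⇒comaximal {P i} {P j} (P-maximal i) (P-maximal j) (i≢j ∘ P-distinct i j)
    ... | x , x≈u = x , λ i → ≡.trans (Equivalence.from (cls≡⇔≈mod (QP i)) (x≈u i)) (cls-rep (QP i) (u i))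

    CommonNeighbour⇔ : (Q : FiniteQuotient R I) (QP : (i : Fin t) → FiniteQuotient R (P i)) (a b : Carrier) (v : Fin (size Q)) →
                       CommonNeighbour R I Q a b v ⇔
                       (∀ i → cls (QP i) a ≢ cls (QP i) (rep Q v) × cls (QP i) b ≢ cls (QP i) (rep Q v))
    CommonNeighbour⇔ Q QP a b v = mk⇔
      (λ (a-unit , b-unit) i → ∉⇒≢ (Equivalence.to (IsUnitMod⇔∉P _) a-unit i) ,
                               ∉⇒≢ (Equivalence.to (IsUnitMod⇔∉P _) b-unit i))
      (λ avoids → Equivalence.from (IsUnitMod⇔∉P _) (λ i → ≢⇒∉ (proj₁ (avoids i))) ,
                  Equivalence.from (IsUnitMod⇔∉P _) (λ i → ≢⇒∉ (proj₂ (avoids i))))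
      where
      ∉⇒≢ : ∀ {i x y} → ¬ mem (P i) (x - y) → cls (QP i) x ≢ cls (QP i) y
      ∉⇒≢ {i} x-y∉P x≡y = x-y∉P (Equivalence.to (cls≡⇔≈mod (QP i)) x≡y)
      ≢⇒∉ : ∀ {i x y} → cls (QP i) x ≢ cls (QP i) y → ¬ mem (P i) (x - y)
      ≢⇒∉ {i} x≢y x-y∈P = x≢y (Equivalence.from (cls≡⇔≈mod (QP i)) x-y∈P)

open import Defs
open import Data.Nat using (ℕ; _≤_; _*_; _∸_)
open import Data.Nat.Properties using (*-commutativeSemigroup)
open import Algebra.Properties.CommutativeSemigroup *-commutativeSemigroup using (xy∙z≈xz∙y)
open import Data.Fin using (Fin)
open import Data.Fin.Subset using (Subset; _∈_; ∣_∣)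
open import Data.Product using (Σ; _×_; _,_)
open import Relation.Binary.PropositionalEquality using (_≡_; trans; cong; module ≡-Reasoning)
open import Function.Bundles using (_⇔_)
open import Function.Properties.Equivalence using () renaming (trans to ⇔-trans; sym to ⇔-sym)
open Counting

lemma6p1 : ∀ {c ℓ} (R : CommutativeRing c ℓ) → IsDedekindDomain R →
    (I : Ideal R) → NonzeroIdeal R I →
    (Q : FiniteQuotient R I) → 2 ≤ size Q →
    (t : ℕ) (P : Fin t → Ideal R) (α : Fin t → ℕ) →
    (∀ i → IsPrimeIdeal R (P i)) →
    (∀ i j → SameIdeal R (P i) (P j) → i ≡ j) →
    (∀ i → 1 ≤ α i) →
    (∀ x → mem I x ⇔ ProdIdealMem R (factorList R t P α) x) →
    (QP : (i : Fin t) → FiniteQuotient R (P i)) →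
    (a b : CommutativeRing.Carrier R) →
    Σ (Subset (size Q)) λ S →
      (∀ v → (v ∈ S) ⇔ CommonNeighbour R I Q a b v) ×
      (∣ S ∣ * prodFin t (λ i → size (QP i))
        ≡ size Q * prodFin t (λ i → size (QP i) ∸ ε R (QP i) (CommutativeRing._-_ R a b)))
lemma6p1 R dedekind I I≢0 Q _ t P α P-prime P-distinct α≥1 I≈∏P QP a b =
  avoiding residues A B , ∈avoiding⇔CommonNeighbour , count
  where
  open CommutativeRing R using (_-_; 0#)
  open IdealTheory R using (module Factorisation; module Residues)
  open Factorisation dedekind I I≢0 P α P-prime P-distinct α≥1 I≈∏P
  open Residues Q QP I⊆P
  open ≡-Reasoning

  p : Fin t → ℕ
  p i = size (QP i)

  A B : Tuple p
  A i = cls (QP i) a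
  B i = cls (QP i) b

  ∈avoiding⇔CommonNeighbour : ∀ v → v ∈ avoiding residues A B ⇔ CommonNeighbour R I Q a b v
  ∈avoiding⇔CommonNeighbour v = ⇔-trans (∈-avoiding⇔ residues A B v) (⇔-sym (CommonNeighbour⇔ Q QP a b v))

  K : ℕ
  K = fibreSize residues (λ i → cls (QP i) 0#)

  fibres : ∀ u → fibreSize residues u ≡ K
  fibres = residues-uniform-fibres (residue-classes-onto QP)

  G : ℕ
  G = prodFin t (λ i → p i ∸ ε R (QP i) (a - b))

  ∣avoiding∣≡K*G : ∣ avoiding residues A B ∣ ≡ K * G
  ∣avoiding∣≡K*G = trans (∣avoiding∣ residues A B K fibres) (cong (K *_) (prodFin-cong t (λ i →
                     ∑-δᶜ-δᶜ (A i) (B i) (memDec R (QP i) (a - b)) (cls-spec (QP i) a b))))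

  count : ∣ avoiding residues A B ∣ * prodFin t p ≡ size Q * G
  count = begin
    ∣ avoiding residues A B ∣ * prodFin t p  ≡⟨ cong (_* prodFin t p) ∣avoiding∣≡K*G ⟩
    K * G * prodFin t p                      ≡⟨ xy∙z≈xz∙y K G (prodFin t p) ⟩
    K * prodFin t p * G                      ≡⟨ cong (_* G) (card-uniform-fibres residues K fibres) ⟨
    size Q * G                               ∎
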